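{- Let $T$ be a tournament with at least three vertices admitting a transitive component $C$ with $|C| = n \geq 2$, and let $C(0),\ldots,C(n-2)$ be as defined in the context. For every $M \subseteq V(T)$, the following are equivalent: (1) $M \in {\rm mc}(T)$ and $M \cap C \neq \emptyset$; (2) $M \in \{C(0),\ldots,C(n-2)\}$.
   Context: A tournament $T$ is a finite vertex set $V(T)$ with an arc set $A(T)$ such that for all distinct $x,y$, exactly one of $(x,y),(y,x)$ lies in $A(T)$; it is transitive if $(x,y),(y,z)\in A(T)$ imply $(x,z)\in A(T)$. A module of $T$ is a subset $M$ such that for all $x,y \in M$ and $v \notin M$, $(v,x)\in A(T)$ iff $(v,y)\in A(T)$; trivial modules are $\emptyset$, singletons and $V(T)$. A transitive component of $T$ is a module $C$ with $T[C]$ transitive, maximal under inclusion among such modules. With $\overline{X} = V(T)\setminus X$, a co-module is a set $M$ such that $M$ or $\overline{M}$ is a nontrivial module; a minimal co-module is one containing no other co-module; ${\rm mc}(T)$ is the set of minimal co-modules. For a transitive component $C$ with $|C|=n\geq 2$, label its elements $v_0,\ldots,v_{n-1}$ so that $(v_i,v_j)\in A(T)$ whenever $0\le i<j\le n-1$. For each $k\in\{0,\ldots,n-2\}$, $\{v_k,v_{k+1}\}$ is a module of $T$ of size 2, and exactly one element of ${\rm mc}(T)$ lies in $\{\{v_k,v_{k+1}\},\{v_k\},\{v_{k+1}\}\}$; this element is denoted $C(k)$. -}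

module Defs where

open import Data.Nat using (ℕ; _≤_; _<_)
open import Data.Bool using (Bool; true; false; not)
open import Data.Fin using (Fin; inject₁; suc) renaming (_<_ to _<ᶠ_)
open import Data.Fin.Subset using (Subset; _∈_; _∉_; _⊆_; ⊥; ⊤; ∁; ⁅_⁆; _∪_; ∣_∣)
open import Data.Product using (Σ; ∃; _×_; _,_)
open import Data.Sum using (_⊎_)
open import Relation.Binary.PropositionalEquality using (_≡_; _≢_)
open import Relation.Nullary using (¬_)
open import Function.Definitions using (Injective)

-- A digraph on vertex set Fin N is given by a Bool-valued arc predicate:
-- (x , y) ∈ A(T)  iff  E x y ≡ true.
Arcs : ℕ → Set
Arcs N = Fin N → Fin N → Bool

IsTournament : ∀ {N} → Arcs N → Set
IsTournament {N} E =
  (∀ x → E x x ≡ false) × (∀ x y → x ≢ y → E x y ≡ not (E y x))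

IsModule : ∀ {N} → Arcs N → Subset N → Set
IsModule E M = ∀ x y v → x ∈ M → y ∈ M → v ∉ M → E v x ≡ E v y

Trivial : ∀ {N} → Subset N → Set
Trivial M = (M ≡ ⊥) ⊎ (∣ M ∣ ≡ 1) ⊎ (M ≡ ⊤)

NontrivialModule : ∀ {N} → Arcs N → Subset N → Set
NontrivialModule E M = IsModule E M × ¬ Trivial M

IsCoModule : ∀ {N} → Arcs N → Subset N → Set
IsCoModule E M = NontrivialModule E M ⊎ NontrivialModule E (∁ M)

-- Minimal co-module: a co-module containing no other co-module.
-- M ∈ mc(T) is rendered as IsMinCoModule E M.
IsMinCoModule : ∀ {N} → Arcs N → Subset N → Set
IsMinCoModule E M =
  IsCoModule E M × (∀ M' → IsCoModule E M' → M' ⊆ M → M' ≡ M)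

TransitiveOn : ∀ {N} → Arcs N → Subset N → Set
TransitiveOn E C = ∀ x y z → x ∈ C → y ∈ C → z ∈ C →
  E x y ≡ true → E y z ≡ true → E x z ≡ true

IsTransitiveComponent : ∀ {N} → Arcs N → Subset N → Set
IsTransitiveComponent E C =
  IsModule E C × TransitiveOn E C ×
  (∀ C' → IsModule E C' → TransitiveOn E C' → C ⊆ C' → C' ≡ C)

-- v : Fin (suc m) → Fin N is the labelling v_0, …, v_m of C
-- (so |C| = n = suc m): injective, image exactly C, and (v_i, v_j) ∈ A for i < j.
IsLabelling : ∀ {N m} → Arcs N → Subset N → (Fin (ℕ.suc m) → Fin N) → Set
IsLabelling E C v =
  Injective _≡_ _≡_ v ×
  (∀ x → x ∈ C → ∃ λ i → v i ≡ x) ×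
  (∀ i → v i ∈ C) ×
  (∀ i j → i <ᶠ j → E (v i) (v j) ≡ true)

-- "M is C(k)" for k ∈ {0, …, m-1} (k : Fin m): M is the (unique, by the
-- context) element of mc(T) lying in {{v_k, v_{k+1}}, {v_k}, {v_{k+1}}}.
IsC : ∀ {N m} → Arcs N → (Fin (ℕ.suc m) → Fin N) → Fin m → Subset N → Set
IsC E v k M =
  IsMinCoModule E M ×
  ((M ≡ ⁅ v (inject₁ k) ⁆ ∪ ⁅ v (suc k) ⁆) ⊎ (M ≡ ⁅ v (inject₁ k) ⁆) ⊎ (M ≡ ⁅ v (suc k) ⁆))

-- Let C be a transitive component of a tournament T (|T| ≥ 3), labelled
-- v₀ → v₁ → … → vₘ with m ≥ 1, and write Pₖ = {vₖ, vₖ₊₁}.  Each Pₖ is a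
-- nontrivial module, hence a co-module.
-- The reverse implication is immediate; for the forward one let M ∈ mc(T)
-- contain vᵢ and split on why M is a co-module.
--
-- * M is a nontrivial module.  If M contains a second vertex of C, the
--   "interval" property of modules inside a labelled component puts some
--   Pₖ inside M, and minimality gives M = Pₖ.  Otherwise M ∩ C = {vᵢ}; then
--   M ∖ C is a module (difference of modules in a tournament), so by
--   minimality it is trivial, i.e. a single vertex w; but then C ∪ M =
--   C ∪ {w} is a transitive module, contradicting maximality of C.
-- * ∁ M is a nontrivial module.  Take Pₖ ∋ vᵢ with other end y.  If y ∈ M
--   then M = Pₖ; otherwise ∁ M ∪ Pₖ is a module (union of overlapping
--   modules) and minimality forces it to be everything, i.e. M = {vᵢ}.

module Submission where

open import Defs
open import Data.Nat using (ℕ; suc; _≤_)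
open import Data.Fin using (Fin)
open import Data.Fin.Subset using (Subset; _∈_)
open import Data.Product using (∃; _×_)
open import Function.Bundles using (_⇔_)

import Data.Nat.Properties as ℕP
open import Data.Nat using (_<_; s≤s; z≤n)
open import Data.Fin using (zero; suc; toℕ; inject₁; lower₁) renaming (_<_ to _<ᶠ_)
import Data.Fin.Properties as FP
open import Data.Fin.Subset using (_∉_; _⊆_; ∁; ⁅_⁆; _∪_; _∩_; ∣_∣)
open import Data.Fin.Subset.Properties
open import Data.Product using (_,_; proj₁; proj₂)
open import Data.Sum using (_⊎_; inj₁; inj₂)
open import Data.Bool using (true; false; not)
open import Data.Bool.Properties using (not-involutive)
open import Data.Vec using (map)
open import Data.Vec.Properties using (map-∘; map-cong; map-id)
open import Data.Empty using (⊥-elim) renaming (⊥ to Empty)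
open import Relation.Binary.PropositionalEquality
open import Relation.Binary using (tri<; tri≈; tri>)
open import Relation.Nullary using (¬_; yes; no)
open import Relation.Nullary.Decidable using (_×-dec_; ¬?)
open import Function using (_∘_)
open import Function.Bundles using (mk⇔)

⁅⁆⊆ : ∀ {N} {S : Subset N} {x} → x ∈ S → ⁅ x ⁆ ⊆ S
⁅⁆⊆ {S = S} {x} x∈S a∈⁅x⁆ = subst (_∈ S) (sym (x∈⁅y⁆⇒x≡y x a∈⁅x⁆)) x∈S

pair-member : ∀ {N} {x y a : Fin N} → a ∈ ⁅ x ⁆ ∪ ⁅ y ⁆ → a ≡ x ⊎ a ≡ y
pair-member {x = x} {y} a∈ with x∈p∪q⁻ ⁅ x ⁆ ⁅ y ⁆ a∈
... | inj₁ a∈⁅x⁆ = inj₁ (x∈⁅y⁆⇒x≡y x a∈⁅x⁆)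
... | inj₂ a∈⁅y⁆ = inj₂ (x∈⁅y⁆⇒x≡y y a∈⁅y⁆)

left∈pair : ∀ {N} {x y : Fin N} → x ∈ ⁅ x ⁆ ∪ ⁅ y ⁆
left∈pair = x∈p∪q⁺ (inj₁ (x∈⁅x⁆ _))

right∈pair : ∀ {N} {x y : Fin N} → y ∈ ⁅ x ⁆ ∪ ⁅ y ⁆
right∈pair = x∈p∪q⁺ (inj₂ (x∈⁅x⁆ _))

pair⊆ : ∀ {N} {S : Subset N} {x y} → x ∈ S → y ∈ S → ⁅ x ⁆ ∪ ⁅ y ⁆ ⊆ S
pair⊆ x∈S y∈S a∈ with pair-member a∈
... | inj₁ refl = x∈S
... | inj₂ refl = y∈S

∁-involutive : ∀ {N} (S : Subset N) → ∁ (∁ S) ≡ S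
∁-involutive S = begin
  ∁ (∁ S)            ≡⟨ sym (map-∘ not not S) ⟩
  map (not ∘ not) S  ≡⟨ map-cong not-involutive S ⟩
  map (λ b → b) S    ≡⟨ map-id S ⟩
  S                  ∎
  where open ≡-Reasoning

distinct-members⇒∣∣≢1 : ∀ {N} {S : Subset N} {x y} → x ≢ y → x ∈ S → y ∈ S → ∣ S ∣ ≢ 1
distinct-members⇒∣∣≢1 {S = S} {x} {y} x≢y x∈S y∈S ∣S∣≡1 =
  ℕP.<-irrefl (trans (∣⁅x⁆∣≡1 x) (sym ∣S∣≡1)) ⁅x⁆⊂S
  where
  ⁅x⁆⊂S : ∣ ⁅ x ⁆ ∣ < ∣ S ∣
  ⁅x⁆⊂S = p⊂q⇒∣p∣<∣q∣ (⁅⁆⊆ x∈S , y , y∈S , x≢y⇒x∉⁅y⁆ (x≢y ∘ sym))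

nontrivial : ∀ {N} {S : Subset N} {x y z} → x ∈ S → y ∈ S → x ≢ y → z ∉ S → ¬ Trivial S
nontrivial {x = x} x∈S _ _ _ (inj₁ S≡∅) = ∉⊥ (subst (x ∈_) S≡∅ x∈S)
nontrivial x∈S y∈S x≢y _ (inj₂ (inj₁ ∣S∣≡1)) = distinct-members⇒∣∣≢1 x≢y x∈S y∈S ∣S∣≡1
nontrivial {z = z} _ _ _ z∉S (inj₂ (inj₂ S≡⊤)) = z∉S (subst (z ∈_) (sym S≡⊤) ∈⊤)

another? : ∀ {N} (S : Subset N) (x : Fin N) → (∃ λ w → w ∈ S × w ≢ x) ⊎ S ⊆ ⁅ x ⁆
another? S x with FP.any? (λ w → (w ∈? S) ×-dec ¬? (w FP.≟ x))
... | yes found = inj₁ found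
... | no none = inj₂ within
  where
  within : S ⊆ ⁅ x ⁆
  within {a} a∈S with a FP.≟ x
  ... | yes refl = x∈⁅x⁆ x
  ... | no a≢x = ⊥-elim (none (a , a∈S , a≢x))

other-member : ∀ {N} {S : Subset N} {x} → x ∈ S → ¬ Trivial S → ∃ λ w → w ∈ S × w ≢ x
other-member {S = S} {x} x∈S nt with another? S x
... | inj₁ found = found
... | inj₂ S⊆⁅x⁆ = ⊥-elim (nt (inj₂ (inj₁ (trans (cong ∣_∣ S≡⁅x⁆) (∣⁅x⁆∣≡1 x)))))
  where
  S≡⁅x⁆ : S ≡ ⁅ x ⁆
  S≡⁅x⁆ = ⊆-antisym S⊆⁅x⁆ (⁅⁆⊆ x∈S)

third : ∀ {N} → 3 ≤ N → (a b : Fin N) → ∃ λ z → z ≢ a × z ≢ b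
third (s≤s (s≤s (s≤s _))) zero zero = suc zero , (λ ()) , (λ ())
third (s≤s (s≤s (s≤s _))) zero (suc zero) = suc (suc zero) , (λ ()) , (λ ())
third (s≤s (s≤s (s≤s _))) zero (suc (suc b)) = suc zero , (λ ()) , (λ ())
third (s≤s (s≤s (s≤s _))) (suc zero) zero = suc (suc zero) , (λ ()) , (λ ())
third (s≤s (s≤s (s≤s _))) (suc (suc a)) zero = suc zero , (λ ()) , (λ ())
third (s≤s (s≤s (s≤s _))) (suc a) (suc b) = zero , (λ ()) , (λ ())

-- Indices: the step k : Fin m joins the positions inject₁ k and suc k

inject₁<suc : ∀ {m} (k : Fin m) → inject₁ k <ᶠ suc k
inject₁<suc k = FP.≤̄⇒inject₁< (FP.≤-refl {x = k})

lower-end : ∀ {m} {a b : Fin (suc m)} → a <ᶠ b → ∃ λ k → inject₁ k ≡ a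
lower-end {m} {a} {b} a<b = lower₁ a m≢a , FP.inject₁-lower₁ a m≢a
  where
  m≢a : m ≢ toℕ a
  m≢a = ℕP.<⇒≢ (ℕP.<-≤-trans a<b (FP.toℕ≤pred[n] b)) ∘ sym

above-step : ∀ {m} (k : Fin m) {b : Fin (suc m)} → inject₁ k <ᶠ b → b ≢ suc k → suc k <ᶠ b
above-step k {b} k<b b≢sk =
  FP.≤∧≢⇒< (subst (λ t → suc t ≤ toℕ b) (FP.toℕ-inject₁ k) k<b) (b≢sk ∘ sym)

end-of-step : ∀ {m} → 1 ≤ m → (i : Fin (suc m)) → ∃ λ k → i ≡ inject₁ k ⊎ i ≡ suc k
end-of-step (s≤s z≤n) zero = zero , inj₁ refl
end-of-step _ (suc k) = k , inj₂ refl

partner : ∀ {m} → 1 ≤ m → (i : Fin (suc m)) → ∃ λ j → j ≢ i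
partner (s≤s z≤n) zero = suc zero , λ ()
partner _ (suc i) = zero , λ ()

false≢true : false ≢ true
false≢true ()

-- Modules in arbitrary digraphs

module _ {N} (E : Arcs N) where

  module-via : (S : Subset N) (b : Fin N) →
    (∀ a u → a ∈ S → u ∉ S → E u a ≡ E u b) → IsModule E S
  module-via S b same x y u x∈S y∈S u∉S = trans (same x u x∈S u∉S) (sym (same y u y∈S u∉S))

  ∪-module : ∀ {A B z} → IsModule E A → IsModule E B → z ∈ A → z ∈ B → IsModule E (A ∪ B)
  ∪-module {A} {B} {z} modA modB z∈A z∈B = module-via (A ∪ B) z same
    where
    same : ∀ a u → a ∈ A ∪ B → u ∉ A ∪ B → E u a ≡ E u z
    same a u a∈ u∉ with x∈p∪q⁻ A B a∈
    ... | inj₁ a∈A = modA a z u a∈A z∈A (u∉ ∘ p⊆p∪q B)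
    ... | inj₂ a∈B = modB a z u a∈B z∈B (u∉ ∘ q⊆p∪q A B)

  transitive-⊆ : ∀ {S S′} → S′ ⊆ S → TransitiveOn E S → TransitiveOn E S′
  transitive-⊆ S′⊆S trS x y z x∈ y∈ z∈ = trS x y z (S′⊆S x∈) (S′⊆S y∈) (S′⊆S z∈)

-- Modules in tournaments

module _ {N} {E : Arcs N} (tour : IsTournament E) where

  private
    loop : ∀ x → E x x ≡ false
    loop = proj₁ tour
    flip : ∀ x y → x ≢ y → E x y ≡ not (E y x)
    flip = proj₂ tour

  -- If C ⊄ M for modules M and C, then M ∖ C is a module: a vertex u of
  -- M ∩ C sees every a ∈ M ∖ C exactly as a vertex c ∈ C ∖ M sees u.
  difference-module : ∀ {M C c} → IsModule E M → IsModule E C → c ∈ C → c ∉ M →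
    IsModule E (M ∩ ∁ C)
  difference-module {M} {C} {c} modM modC c∈C c∉M a b u a∈ b∈ u∉ with u ∈? M
  ... | no u∉M = modM a b u (proj₁ (x∈p∩q⁻ M (∁ C) a∈)) (proj₁ (x∈p∩q⁻ M (∁ C) b∈)) u∉M
  ... | yes u∈M = trans (seen-as-c a∈) (sym (seen-as-c b∈))
    where
    u∈C : u ∈ C
    u∈C = x∉∁p⇒x∈p (u∉ ∘ λ u∈∁C → x∈p∩q⁺ (u∈M , u∈∁C))
    seen-as-c : ∀ {a} → a ∈ M ∩ ∁ C → E u a ≡ E c u
    seen-as-c {a} a∈ = begin
      E u a        ≡⟨ flip u a (λ u≡a → a∉C (subst (_∈ C) u≡a u∈C)) ⟩
      not (E a u)  ≡⟨ cong not (modC u c a u∈C c∈C a∉C) ⟩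
      not (E a c)  ≡⟨ sym (flip c a (λ c≡a → a∉C (subst (_∈ C) c≡a c∈C))) ⟩
      E c a        ≡⟨ modM a u c a∈M u∈M c∉M ⟩
      E c u        ∎
      where
      open ≡-Reasoning
      a∈M : a ∈ M
      a∈M = proj₁ (x∈p∩q⁻ M (∁ C) a∈)
      a∉C : a ∉ C
      a∉C = x∈∁p⇒x∉p (proj₂ (x∈p∩q⁻ M (∁ C) a∈))

  -- Adjoining to a transitive module C one outside vertex w keeps the
  -- subtournament transitive: w dominates all of C or is dominated by it.
  adjoin-transitive : ∀ {C w} → IsModule E C → TransitiveOn E C → w ∉ C →
    TransitiveOn E (C ∪ ⁅ w ⁆)
  adjoin-transitive {C} {w} modC trC w∉C x y z x∈ y∈ z∈ =
    by-cases x y z (split x∈) (split y∈) (split z∈)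
    where
    split : ∀ {a} → a ∈ C ∪ ⁅ w ⁆ → a ∈ C ⊎ a ≡ w
    split {a} a∈ with x∈p∪q⁻ C ⁅ w ⁆ a∈
    ... | inj₁ a∈C = inj₁ a∈C
    ... | inj₂ a∈⁅w⁆ = inj₂ (x∈⁅y⁆⇒x≡y w a∈⁅w⁆)
    uniform : ∀ {d d′} → d ∈ C → d′ ∈ C → E w d ≡ E w d′
    uniform d∈C d′∈C = modC _ _ w d∈C d′∈C w∉C
    into-w : ∀ {d} → d ∈ C → E d w ≡ not (E w d)
    into-w {d} d∈C = flip d w (λ d≡w → w∉C (subst (_∈ C) d≡w d∈C))
    no-loop : E w w ≡ true → Empty
    no-loop ww = false≢true (trans (sym (loop w)) ww)
    not-both : ∀ {d} → E w d ≡ true → not (E w d) ≡ true → Empty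
    not-both wd ¬wd = false≢true (trans (sym (cong not wd)) ¬wd)
    by-cases : ∀ x y z → x ∈ C ⊎ x ≡ w → y ∈ C ⊎ y ≡ w → z ∈ C ⊎ z ≡ w →
      E x y ≡ true → E y z ≡ true → E x z ≡ true
    by-cases x y z (inj₁ x∈C) (inj₁ y∈C) (inj₁ z∈C) xy yz = trC x y z x∈C y∈C z∈C xy yz
    by-cases _ _ _ _ (inj₂ refl) (inj₂ refl) _ yz = ⊥-elim (no-loop yz)
    by-cases _ _ _ (inj₂ refl) (inj₂ refl) _ xy _ = ⊥-elim (no-loop xy)
    by-cases _ _ _ (inj₂ refl) (inj₁ y∈C) (inj₂ refl) xy yz =
      ⊥-elim (not-both xy (trans (sym (into-w y∈C)) yz))
    by-cases _ _ _ (inj₂ refl) (inj₁ y∈C) (inj₁ z∈C) xy _ = trans (uniform z∈C y∈C) xy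
    by-cases _ _ _ (inj₁ x∈C) (inj₂ refl) (inj₁ z∈C) xy yz =
      ⊥-elim (not-both (trans (uniform x∈C z∈C) yz) (trans (sym (into-w x∈C)) xy))
    by-cases _ _ _ (inj₁ x∈C) (inj₁ y∈C) (inj₂ refl) _ yz =
      trans (into-w x∈C) (trans (cong not (uniform x∈C y∈C)) (trans (sym (into-w y∈C)) yz))

-- Then M = P or M = {x}: if y ∉ M, then
-- ∁ M ∪ P is a module, and its complement, a co-module inside M missing x,
-- must be empty.
complement-case : ∀ {N} {E : Arcs N} {M : Subset N} {x y} →
  IsMinCoModule E M → IsModule E (∁ M) → NontrivialModule E (⁅ x ⁆ ∪ ⁅ y ⁆) →
  x ≢ y → x ∈ M → M ≡ ⁅ x ⁆ ∪ ⁅ y ⁆ ⊎ M ≡ ⁅ x ⁆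
complement-case {E = E} {M} {x} {y} (_ , minimal) mod∁M ntmP@(modP , _) x≢y x∈M with y ∈? M
... | yes y∈M = inj₁ (sym (minimal (⁅ x ⁆ ∪ ⁅ y ⁆) (inj₁ ntmP) (pair⊆ x∈M y∈M)))
... | no y∉M = inj₂ (⊆-antisym M⊆⁅x⁆ (⁅⁆⊆ x∈M))
  where
  P K : Subset _
  P = ⁅ x ⁆ ∪ ⁅ y ⁆
  K = ∁ M ∪ P
  x∈K : x ∈ K
  x∈K = q⊆p∪q (∁ M) P left∈pair
  y∈K : y ∈ K
  y∈K = q⊆p∪q (∁ M) P right∈pair
  modK : IsModule E K
  modK = ∪-module E mod∁M modP (x∉p⇒x∈∁p y∉M) right∈pair
  ∁K⊆M : ∁ K ⊆ M
  ∁K⊆M a∈∁K = x∉∁p⇒x∈p (λ a∈∁M → x∈∁p⇒x∉p a∈∁K (p⊆p∪q P a∈∁M))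
  -- If some vertex a lay outside K, ∁ K would be a co-module inside M.
  K-full : ∀ a → a ∈ K
  K-full a with a ∈? K
  ... | yes a∈K = a∈K
  ... | no a∉K = ⊥-elim (x∈∁p⇒x∉p (subst (x ∈_) (sym ∁K≡M) x∈M) x∈K)
    where
    ∁K-co-module : IsCoModule E (∁ K)
    ∁K-co-module = inj₂ (subst (NontrivialModule E) (sym (∁-involutive K))
                          (modK , nontrivial x∈K y∈K x≢y a∉K))
    ∁K≡M : ∁ K ≡ M
    ∁K≡M = minimal (∁ K) ∁K-co-module ∁K⊆M
  M⊆⁅x⁆ : M ⊆ ⁅ x ⁆
  M⊆⁅x⁆ {a} a∈M with x∈p∪q⁻ (∁ M) P (K-full a)
  ... | inj₁ a∈∁M = ⊥-elim (x∈∁p⇒x∉p a∈∁M a∈M)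
  ... | inj₂ a∈P with pair-member a∈P
  ...   | inj₁ refl = x∈⁅x⁆ x
  ...   | inj₂ refl = ⊥-elim (y∉M a∈M)

-- Otherwise D = M ∖ C is a module; it is nonempty and
-- misses x, so minimality forbids a second vertex in D; but if D = {w},
-- then C ∪ M = C ∪ {w} is a transitive module, against maximality of C.
single-meeting-impossible : ∀ {N} {E : Arcs N} {C M : Subset N} {x c} →
  IsTournament E → IsTransitiveComponent E C →
  IsMinCoModule E M → NontrivialModule E M →
  x ∈ M → x ∈ C → M ∩ C ⊆ ⁅ x ⁆ → c ∈ C → c ∉ M → Empty
single-meeting-impossible {E = E} {C} {M} {x} tour (modC , trC , maximal) (_ , minimal)
  (modM , ntM) x∈M x∈C M∩C⊆⁅x⁆ c∈C c∉M = conclude (another? D w)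
  where
  D : Subset _
  D = M ∩ ∁ C
  modD : IsModule E D
  modD = difference-module tour modM modC c∈C c∉M
  D⊆M : D ⊆ M
  D⊆M a∈D = proj₁ (x∈p∩q⁻ M (∁ C) a∈D)
  x∉D : x ∉ D
  x∉D x∈D = x∈∁p⇒x∉p (proj₂ (x∈p∩q⁻ M (∁ C) x∈D)) x∈C
  outside-C : ∀ {a} → a ∈ M → a ∉ C → a ∈ D
  outside-C a∈M a∉C = x∈p∩q⁺ (a∈M , x∉p⇒x∈∁p a∉C)
  w : Fin _
  w = proj₁ (other-member x∈M ntM)
  w∈M : w ∈ M
  w∈M = proj₁ (proj₂ (other-member x∈M ntM))
  w∉C : w ∉ C
  w∉C w∈C = proj₂ (proj₂ (other-member x∈M ntM)) (x∈⁅y⁆⇒x≡y x (M∩C⊆⁅x⁆ (x∈p∩q⁺ (w∈M , w∈C))))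
  w∈D : w ∈ D
  w∈D = outside-C w∈M w∉C
  conclude : (∃ λ w′ → w′ ∈ D × w′ ≢ w) ⊎ D ⊆ ⁅ w ⁆ → Empty
  conclude (inj₁ (w′ , w′∈D , w′≢w)) = x∉D (subst (x ∈_) (sym D≡M) x∈M)
    where
    D≡M : D ≡ M
    D≡M = minimal D (inj₁ (modD , nontrivial w′∈D w∈D w′≢w x∉D)) D⊆M
  conclude (inj₂ D⊆⁅w⁆) = w∉C (subst (w ∈_) C∪M≡C (q⊆p∪q C M w∈M))
    where
    C∪M⊆C∪⁅w⁆ : C ∪ M ⊆ C ∪ ⁅ w ⁆
    C∪M⊆C∪⁅w⁆ {a} a∈ with x∈p∪q⁻ C M a∈ | a ∈? C
    ... | _ | yes a∈C = p⊆p∪q ⁅ w ⁆ a∈C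
    ... | inj₁ a∈C | no a∉C = ⊥-elim (a∉C a∈C)
    ... | inj₂ a∈M | no a∉C = q⊆p∪q C ⁅ w ⁆ (D⊆⁅w⁆ (outside-C a∈M a∉C))
    C∪M≡C : C ∪ M ≡ C
    C∪M≡C = maximal (C ∪ M) (∪-module E modC modM x∈C x∈M)
      (transitive-⊆ E C∪M⊆C∪⁅w⁆ (adjoin-transitive tour modC trC w∉C)) (p⊆p∪q M)

-- A labelled transitive component v₀ → v₁ → … → vₘ

module Labelled {N m} {E : Arcs N} (tour : IsTournament E) {C : Subset N}
  (component : IsTransitiveComponent E C)
  (v : Fin (suc m) → Fin N) (labelling : IsLabelling E C v) where

  private
    modC : IsModule E C
    modC = proj₁ component
    injective : ∀ {i j} → v i ≡ v j → i ≡ j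
    injective = proj₁ labelling
    onto : ∀ x → x ∈ C → ∃ λ i → v i ≡ x
    onto = proj₁ (proj₂ labelling)
    inC : ∀ i → v i ∈ C
    inC = proj₁ (proj₂ (proj₂ labelling))
    ascending : ∀ i j → i <ᶠ j → E (v i) (v j) ≡ true
    ascending = proj₂ (proj₂ (proj₂ labelling))

  descending : ∀ i j → j <ᶠ i → E (v i) (v j) ≡ false
  descending i j j<i =
    trans (proj₂ tour (v i) (v j) (FP.<⇒≢ j<i ∘ sym ∘ injective)) (cong not (ascending j i j<i))

  step : Fin m → Subset N
  step k = ⁅ v (inject₁ k) ⁆ ∪ ⁅ v (suc k) ⁆

  step-ends-distinct : ∀ k → v (inject₁ k) ≢ v (suc k)
  step-ends-distinct k = FP.<⇒≢ (inject₁<suc k) ∘ injective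

  -- A vertex outside step k sees both of its ends alike: outside C because
  -- C is a module, inside C because its label is below both or above both.
  outside-step : ∀ k u → u ∉ step k → E u (v (inject₁ k)) ≡ E u (v (suc k))
  outside-step k u u∉ with u ∈? C
  ... | no u∉C = modC _ _ u (inC _) (inC _) u∉C
  ... | yes u∈C with onto u u∈C
  ...   | l , refl with FP.<-cmp l (inject₁ k)
  ...     | tri< l<k _ _ =
    trans (ascending l _ l<k) (sym (ascending l (suc k) (FP.<-trans l<k (inject₁<suc k))))
  ...     | tri≈ _ refl _ = ⊥-elim (u∉ left∈pair)
  ...     | tri> _ _ k<l =
    trans (descending l _ k<l) (sym (descending l (suc k) (above-step k k<l l≢sk)))
    where
    l≢sk : l ≢ suc k
    l≢sk l≡sk = u∉ (subst (λ t → v t ∈ step k) (sym l≡sk) right∈pair)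

  step-module : ∀ k → IsModule E (step k)
  step-module k = module-via E (step k) (v (inject₁ k)) same
    where
    same : ∀ a u → a ∈ step k → u ∉ step k → E u a ≡ E u (v (inject₁ k))
    same a u a∈ u∉ with pair-member a∈
    ... | inj₁ refl = refl
    ... | inj₂ refl = sym (outside-step k u u∉)

  step-nontrivial-module : 3 ≤ N → ∀ k → NontrivialModule E (step k)
  step-nontrivial-module N3 k with third N3 (v (inject₁ k)) (v (suc k))
  ... | z , z≢lo , z≢hi = step-module k ,
    nontrivial left∈pair right∈pair (step-ends-distinct k) z∉step
    where
    z∉step : z ∉ step k
    z∉step z∈ with pair-member z∈
    ... | inj₁ z≡lo = z≢lo z≡lo
    ... | inj₂ z≡hi = z≢hi z≡hi

  -- Interval property: a module containing vₖ and some later vertex of C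
  -- also contains vₖ₊₁ (else vₖ₊₁ would see vₖ and the later one alike).
  interval : ∀ {M} k {b} → IsModule E M → v (inject₁ k) ∈ M → v b ∈ M →
    inject₁ k <ᶠ b → v (suc k) ∈ M
  interval {M} k {b} modM lo∈M b∈M k<b with v (suc k) ∈? M
  ... | yes hi∈M = hi∈M
  ... | no hi∉M = ⊥-elim (false≢true (begin
    false                     ≡⟨ sym (descending (suc k) (inject₁ k) (inject₁<suc k)) ⟩
    E (v (suc k)) (v (inject₁ k)) ≡⟨ modM _ _ _ lo∈M b∈M hi∉M ⟩
    E (v (suc k)) (v b)       ≡⟨ ascending (suc k) b (above-step k k<b b≢sk) ⟩
    true                      ∎))
    where
    open ≡-Reasoning
    b≢sk : b ≢ suc k
    b≢sk b≡sk = hi∉M (subst (λ t → v t ∈ M) b≡sk b∈M)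

  step-from : ∀ {M} → IsModule E M → ∀ {a b} → a <ᶠ b → v a ∈ M → v b ∈ M →
    ∃ λ k → step k ⊆ M
  step-from modM a<b a∈M b∈M with lower-end a<b
  ... | k , refl = k , pair⊆ a∈M (interval k modM a∈M b∈M a<b)

  step-inside : ∀ {M} → IsModule E M → ∀ {a b} → v a ∈ M → v b ∈ M → a ≢ b →
    ∃ λ k → step k ⊆ M
  step-inside modM {a} {b} a∈M b∈M a≢b with FP.<-cmp a b
  ... | tri< a<b _ _ = step-from modM a<b a∈M b∈M
  ... | tri≈ _ a≡b _ = ⊥-elim (a≢b a≡b)
  ... | tri> _ _ b<a = step-from modM b<a b∈M a∈M

  Candidate : Fin m → Subset N → Set
  Candidate k M = M ≡ step k ⊎ M ≡ ⁅ v (inject₁ k) ⁆ ⊎ M ≡ ⁅ v (suc k) ⁆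

  module-case : 3 ≤ N → 1 ≤ m → ∀ {M} → IsMinCoModule E M → NontrivialModule E M →
    ∀ {i} → v i ∈ M → ∃ λ k → M ≡ step k
  module-case N3 m1 {M} minM ntmM@(modM , _) {i} vi∈M with another? (M ∩ C) (v i)
  ... | inj₁ (y , y∈M∩C , y≢vi) with onto y (proj₂ (x∈p∩q⁻ M C y∈M∩C))
  ...   | j , refl with step-inside modM vi∈M (proj₁ (x∈p∩q⁻ M C y∈M∩C)) (y≢vi ∘ cong v ∘ sym)
  ...     | k , step⊆M = k , sym (proj₂ minM (step k) (inj₁ (step-nontrivial-module N3 k)) step⊆M)
  module-case N3 m1 {M} minM ntmM {i} vi∈M | inj₂ M∩C⊆⁅vi⁆ =
    ⊥-elim (single-meeting-impossible tour component minM ntmM vi∈M (inC i) M∩C⊆⁅vi⁆ (inC j) vj∉M)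
    where
    j : Fin (suc m)
    j = proj₁ (partner m1 i)
    vj∉M : v j ∉ M
    vj∉M vj∈M = proj₂ (partner m1 i)
      (injective (x∈⁅y⁆⇒x≡y (v i) (M∩C⊆⁅vi⁆ (x∈p∩q⁺ (vj∈M , inC j)))))

  complement-module-case : 3 ≤ N → 1 ≤ m → ∀ {M} → IsMinCoModule E M → IsModule E (∁ M) →
    ∀ {i} → v i ∈ M → ∃ λ k → Candidate k M
  complement-module-case N3 m1 minM mod∁M {i} vi∈M with end-of-step m1 i
  ... | k , inj₁ refl with complement-case minM mod∁M (step-nontrivial-module N3 k)
                              (step-ends-distinct k) vi∈M
  ...   | inj₁ M≡step = k , inj₁ M≡step
  ...   | inj₂ M≡lo = k , inj₂ (inj₁ M≡lo)
  complement-module-case N3 m1 minM mod∁M {i} vi∈M | k , inj₂ refl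
    with complement-case minM mod∁M
           (subst (NontrivialModule E) (∪-comm _ _) (step-nontrivial-module N3 k))
           (step-ends-distinct k ∘ sym) vi∈M
  ... | inj₁ M≡step = k , inj₁ (trans M≡step (∪-comm _ _))
  ... | inj₂ M≡hi = k , inj₂ (inj₂ M≡hi)

  meeting⇒candidate : 3 ≤ N → 1 ≤ m → ∀ {M} → IsMinCoModule E M →
    (∃ λ x → x ∈ M × x ∈ C) → ∃ λ k → Candidate k M
  meeting⇒candidate N3 m1 minM (x , x∈M , x∈C) with onto x x∈C | proj₁ minM
  ... | i , refl | inj₁ ntmM = let k , M≡step = module-case N3 m1 minM ntmM x∈M in k , inj₁ M≡step
  ... | i , refl | inj₂ (mod∁M , _) = complement-module-case N3 m1 minM mod∁M x∈M

  candidate-meets-C : ∀ {k M} → Candidate k M → ∃ λ x → x ∈ M × x ∈ C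
  candidate-meets-C {k} (inj₁ refl) = v (inject₁ k) , left∈pair , inC _
  candidate-meets-C {k} (inj₂ (inj₁ refl)) = v (inject₁ k) , x∈⁅x⁆ _ , inC _
  candidate-meets-C {k} (inj₂ (inj₂ refl)) = v (suc k) , x∈⁅x⁆ _ , inC _

lemma5 : ∀ {N m} (E : Arcs N) → IsTournament E → 3 ≤ N →
    (C : Subset N) → IsTransitiveComponent E C →
    1 ≤ m → (v : Fin (suc m) → Fin N) → IsLabelling E C v →
    (M : Subset N) →
    ((IsMinCoModule E M × ∃ λ x → x ∈ M × x ∈ C) ⇔ (∃ λ k → IsC E v k M))
lemma5 E tour N3 C component m1 v labelling M = mk⇔ meeting⇒step step⇒meeting
  where
  open Labelled tour component v labelling
  meeting⇒step : IsMinCoModule E M × (∃ λ x → x ∈ M × x ∈ C) → ∃ λ k → IsC E v k M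
  meeting⇒step (minM , meets) = let k , cand = meeting⇒candidate N3 m1 minM meets in k , minM , cand
  step⇒meeting : (∃ λ k → IsC E v k M) → IsMinCoModule E M × (∃ λ x → x ∈ M × x ∈ C)
  step⇒meeting (k , minM , cand) = minM , candidate-meets-C cand
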